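{- For every integer $k\ge 1$, let $B_k$ be the graph with vertex set $\{b^i_j \mid i,j\in\{1,\dots,k\}\}$ in which $b^i_j$ and $b^{i'}_{j'}$ are adjacent iff $i\neq i'$ and $j\neq j'$, and let $\alpha^k,\beta^k$ be the $k$-colorings of $B_k$ given by $\alpha^k(b^i_j)=i$ and $\beta^k(b^i_j)=j$. Then: (1) every recoloring sequence from $\alpha^k$ to $\beta^k$ contains a coloring that uses at least $2k-1$ different colors; and (2) there exists a $(2k-1)$-recoloring sequence from $\alpha^k$ to $\beta^k$ of length at most $2k^2$.
   Context: A $k$-coloring of a graph $G$ is a map $V(G)\to\{1,\dots,k\}$ assigning different colors to adjacent vertices. The $k$-color graph $\mathcal{C}_k(G)$ has as vertices the $k$-colorings of $G$, adjacent iff they differ on exactly one vertex. A $k$-recoloring sequence from $\alpha$ to $\beta$ is a sequence $\alpha_0=\alpha,\alpha_1,\dots,\alpha_m=\beta$ of $k$-colorings such that for each $i$, either $\alpha_i=\alpha_{i+1}$ or $\alpha_i$ and $\alpha_{i+1}$ are adjacent in $\mathcal{C}_k(G)$; its length is $m$. A recoloring sequence is a $k$-recoloring sequence for some integer $k$. The set of colors used by a coloring $\gamma$ is $\{\gamma(v)\mid v\in V(G)\}$. -}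

module Defs where

open import Data.Nat using (ℕ; zero; suc; _<_; _≤_)
open import Data.Nat.Properties using (_≟_)
open import Data.Fin using (Fin; toℕ)
open import Data.Product using (_×_; _,_; Σ; ∃)
open import Data.Sum using (_⊎_)
open import Data.List using (List; map; length; deduplicate; cartesianProduct; allFin)
open import Relation.Binary.PropositionalEquality using (_≡_; _≢_)

record Graph : Set₁ where
  field
    V   : Set
    Adj : V → V → Set

open Graph public

-- A coloring assigns natural numbers as colors (colors are 0-based here:
-- colour c ∈ ℕ corresponds to the paper's colour c+1).
Coloring : Graph → Set
Coloring G = V G → ℕ

Proper : (G : Graph) → Coloring G → Set
Proper G γ = ∀ u v → Adj G u v → γ u ≢ γ v

IsKColoring : (G : Graph) → ℕ → Coloring G → Set
IsKColoring G k γ = Proper G γ × (∀ v → γ v < k)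

DifferOnExactlyOne : (G : Graph) → Coloring G → Coloring G → Set
DifferOnExactlyOne G γ δ =
  Σ (V G) λ v → (γ v ≢ δ v) × (∀ w → w ≢ v → γ w ≡ δ w)

Step : (G : Graph) → Coloring G → Coloring G → Set
Step G γ δ = (∀ v → γ v ≡ δ v) ⊎ DifferOnExactlyOne G γ δ

IsRecoloringSeq : (G : Graph) (k : ℕ) (α β : Coloring G) (m : ℕ) → (ℕ → Coloring G) → Set
IsRecoloringSeq G k α β m seq =
    (∀ v → seq 0 v ≡ α v)
  × (∀ v → seq m v ≡ β v)
  × (∀ i → i ≤ m → IsKColoring G k (seq i))
  × (∀ i → i < m → Step G (seq i) (seq (suc i)))

B : ℕ → Graph
B k = record
  { V   = Fin k × Fin k
  ; Adj = λ { (i , j) (i' , j') → (i ≢ i') × (j ≢ j') } }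

vertsB : (k : ℕ) → List (Fin k × Fin k)
vertsB k = cartesianProduct (allFin k) (allFin k)

numColorsB : (k : ℕ) → Coloring (B k) → ℕ
numColorsB k γ = length (deduplicate _≟_ (map γ (vertsB k)))

αB : (k : ℕ) → Coloring (B k)
αB k (i , j) = toℕ i

βB : (k : ℕ) → Coloring (B k)
βB k (i , j) = toℕ j

module Submission where

-- In a proper coloring of B_k two cells of the same color share a row or a column, so a color
-- repeated within a row occurs nowhere outside that row, and likewise for columns. In α no column
-- contains a repeated color and in β every column does; take a step γ → δ of the sequence after
-- which every column repeats while before it some column c of γ does not. If some row r of γ has
-- no repeated color either, row r together with column c carries 2k − 1 distinct colors.
-- Otherwise every row of γ repeats; the single recolored cell of the step breaks the repeat of at
-- most one row, and in δ the repeated colors of the remaining k − 1 rows and of the k columns are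
-- 2k − 1 distinct colors.

open import Defs
open import Data.Bool using (Bool; true; false)
open import Data.Fin using (Fin; toℕ; punchIn; splitAt; join; combine)
  renaming (zero to fzero; suc to fsuc)
open import Data.Fin.Properties
  using (toℕ-injective; toℕ<n; toℕ≤pred[n]; punchIn-injective; punchInᵢ≢i; injective⇒≤;
         join-splitAt; combine-injective; combine-monoˡ-<; any?; all?; ¬∀⟶∃¬)
  renaming (_≟_ to _≟ᶠ_)
open import Data.List using (List; map; deduplicate; lookup)
open import Data.List.Membership.Propositional using (_∈_)
open import Data.List.Membership.Propositional.Properties
  using (∈-deduplicate⁺; ∈-map⁺; ∈-cartesianProduct⁺; ∈-allFin)
open import Data.List.Relation.Unary.Any using (index)
open import Data.List.Relation.Unary.Any.Properties using (lookup-index)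
open import Data.Nat using (ℕ; zero; suc; _≤_; _<_; _+_; _*_; _∸_; z≤n; _<?_; _<ᵇ_)
open import Data.Nat.Properties
  using (_≟_; ≤-refl; <-asym; <-≤-trans; <⇒≤; <⇒≱; <⇒≢; ≮⇒≥; ≤∧≢⇒<;
         m≤n⇒m≤1+n; m+n≮m; m≤m+n; +-suc; +-identityʳ; +-cancelˡ-≡;
         +-cancelˡ-<; +-monoʳ-<; ≤-antisym; <ᵇ-reflects-<)
open import Data.Product using (_×_; _,_; Σ; ∃; ∃₂; proj₁; proj₂)
open import Data.Sum using (_⊎_; inj₁; inj₂)
open import Function using (_∘_)
open import Function.Definitions using (Injective)
open import Relation.Binary.PropositionalEquality
open import Relation.Nullary using (¬_; yes; no; ¬?; contradiction)
open import Relation.Nullary.Reflects using (ofʸ; ofⁿ)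
open import Relation.Nullary.Decidable using (_×-dec_; decidable-stable)
open import Relation.Unary using (Decidable)

module _ {k : ℕ} (γ : Coloring (B k)) where

  injective⇒≤numColorsB : ∀ {n} (f : Fin n → V (B k)) → Injective _≡_ _≡_ (γ ∘ f) →
                          n ≤ numColorsB k γ
  injective⇒≤numColorsB f inj = injective⇒≤ {f = position} (inj ∘ samePosition)
    where
    colors : List ℕ
    colors = deduplicate _≟_ (map γ (vertsB k))
    listed : ∀ a → γ (f a) ∈ colors
    listed a = ∈-deduplicate⁺ _≟_ (∈-map⁺ γ (∈-cartesianProduct⁺ (∈-allFin _) (∈-allFin _)))
    position : Fin _ → Fin _
    position a = index (listed a)
    samePosition : ∀ {a b} → position a ≡ position b → γ (f a) ≡ γ (f b)
    samePosition {a} {b} eq =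
      trans (lookup-index (listed a)) (trans (cong (lookup colors) eq) (sym (lookup-index (listed b))))

  injective⊎⇒≤numColorsB : ∀ {m n} (f : Fin m ⊎ Fin n → V (B k)) → Injective _≡_ _≡_ (γ ∘ f) →
                           m + n ≤ numColorsB k γ
  injective⊎⇒≤numColorsB {m} {n} f inj = injective⇒≤numColorsB (f ∘ splitAt m) λ {a} {b} eq →
    trans (sym (join-splitAt m n a)) (trans (cong (join m n) (inj eq)) (join-splitAt m n b))

module _ {k : ℕ} where

  RowRepeats : Coloring (B k) → Fin k → Set
  RowRepeats γ r = ∃₂ λ j j' → j ≢ j' × γ (r , j) ≡ γ (r , j')

  transpose : Coloring (B k) → Coloring (B k)
  transpose γ (i , j) = γ (j , i)

  ColumnRepeats : Coloring (B k) → Fin k → Set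
  ColumnRepeats γ = RowRepeats (transpose γ)

  rowRepeats? : ∀ γ → Decidable (RowRepeats γ)
  rowRepeats? γ r = any? λ j → any? λ j' → ¬? (j ≟ᶠ j') ×-dec (γ (r , j) ≟ γ (r , j'))

  columnRepeats? : ∀ γ → Decidable (ColumnRepeats γ)
  columnRepeats? γ = rowRepeats? (transpose γ)

  transpose-proper : ∀ {γ} → Proper (B k) γ → Proper (B k) (transpose γ)
  transpose-proper proper (i , j) (i' , j') (i≢i' , j≢j') = proper (j , i) (j' , i') (j≢j' , i≢i')

  sameColor⇒sameRow⊎sameColumn : ∀ {γ} → Proper (B k) γ → ∀ {a b a' b'} →
                                 γ (a , b) ≡ γ (a' , b') → a ≡ a' ⊎ b ≡ b'
  sameColor⇒sameRow⊎sameColumn proper {a} {b} {a'} {b'} eq with a ≟ᶠ a' | b ≟ᶠ b'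
  ... | yes a≡a' | _        = inj₁ a≡a'
  ... | no _     | yes b≡b' = inj₂ b≡b'
  ... | no a≢a'  | no b≢b'  = contradiction eq (proper (a , b) (a' , b') (a≢a' , b≢b'))

  repeatedColor-inRow : ∀ {γ} → Proper (B k) γ → ∀ {r j j' s x} → j ≢ j' →
                        γ (r , j) ≡ γ (r , j') → γ (r , j) ≡ γ (s , x) → s ≡ r
  repeatedColor-inRow proper j≢j' repeat eq
    with sameColor⇒sameRow⊎sameColumn proper eq
       | sameColor⇒sameRow⊎sameColumn proper (trans (sym repeat) eq)
  ... | inj₁ r≡s  | _         = sym r≡s
  ... | inj₂ _    | inj₁ r≡s  = sym r≡s
  ... | inj₂ j≡x  | inj₂ j'≡x = contradiction (trans j≡x (sym j'≡x)) j≢j'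

  rowRepeats-unchanged : ∀ {γ δ r} → (∀ j → γ (r , j) ≡ δ (r , j)) →
                         RowRepeats γ r → RowRepeats δ r
  rowRepeats-unchanged same (j , j' , j≢j' , repeat) =
    j , j' , j≢j' , trans (sym (same j)) (trans repeat (same j'))

rainbowRowAndColumn⇒≤numColorsB :
  ∀ {n} {γ : Coloring (B (suc n))} → Proper (B (suc n)) γ → ∀ r c →
  ¬ RowRepeats γ r → ¬ ColumnRepeats γ c → suc n + n ≤ numColorsB (suc n) γ
rainbowRowAndColumn⇒≤numColorsB {n} {γ} proper r c rainbowRow rainbowColumn =
  injective⊎⇒≤numColorsB γ cell distinct
  where
  cell : Fin (suc n) ⊎ Fin n → Fin (suc n) × Fin (suc n)
  cell (inj₁ j) = r , j
  cell (inj₂ t) = punchIn r t , c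
  rowNotColumn : ∀ j t → γ (r , j) ≢ γ (punchIn r t , c)
  rowNotColumn j t eq with sameColor⇒sameRow⊎sameColumn proper eq
  ... | inj₁ r≡i   = punchInᵢ≢i r t (sym r≡i)
  ... | inj₂ refl  = rainbowColumn (r , punchIn r t , ≢-sym (punchInᵢ≢i r t) , eq)
  distinct : Injective _≡_ _≡_ (γ ∘ cell)
  distinct {inj₁ j} {inj₁ j'} eq with j ≟ᶠ j'
  ... | yes j≡j' = cong inj₁ j≡j'
  ... | no j≢j'  = contradiction (j , j' , j≢j' , eq) rainbowRow
  distinct {inj₂ t} {inj₂ t'} eq with punchIn r t ≟ᶠ punchIn r t'
  ... | yes i≡i' = cong inj₂ (punchIn-injective r t t' i≡i')
  ... | no i≢i'  = contradiction (_ , _ , i≢i' , eq) rainbowColumn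
  distinct {inj₁ j} {inj₂ t} eq = contradiction eq (rowNotColumn j t)
  distinct {inj₂ t} {inj₁ j} eq = contradiction (sym eq) (rowNotColumn j t)

repeatsAlmostEverywhere⇒≤numColorsB :
  ∀ {n} {γ : Coloring (B (suc n))} → Proper (B (suc n)) γ → ∀ r₀ →
  (∀ r → r ≢ r₀ → RowRepeats γ r) → (∀ c → ColumnRepeats γ c) →
  suc n + n ≤ numColorsB (suc n) γ
repeatsAlmostEverywhere⇒≤numColorsB {n} {γ} proper r₀ rowRepeats columnRepeats =
  injective⊎⇒≤numColorsB γ cell distinct
  where
  otherRowRepeats : (t : Fin n) → RowRepeats γ (punchIn r₀ t)
  otherRowRepeats t = rowRepeats (punchIn r₀ t) (punchInᵢ≢i r₀ t)
  cell : Fin (suc n) ⊎ Fin n → Fin (suc n) × Fin (suc n)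
  cell (inj₁ c) = proj₁ (columnRepeats c) , c
  cell (inj₂ t) = punchIn r₀ t , proj₁ (otherRowRepeats t)
  inColumn : ∀ {c s x} → γ (cell (inj₁ c)) ≡ γ (x , s) → s ≡ c
  inColumn {c} with columnRepeats c
  ... | _ , _ , i≢i' , repeat = repeatedColor-inRow (transpose-proper proper) i≢i' repeat
  inRow : ∀ {t s x} → γ (cell (inj₂ t)) ≡ γ (s , x) → s ≡ punchIn r₀ t
  inRow {t} with otherRowRepeats t
  ... | _ , _ , j≢j' , repeat = repeatedColor-inRow proper j≢j' repeat
  columnNotRow : ∀ c t → γ (cell (inj₁ c)) ≢ γ (cell (inj₂ t))
  columnNotRow c t eq with columnRepeats c
  ... | i , i' , i≢i' , repeat =
    i≢i' (trans (inRow (sym eq)) (sym (inRow (trans (sym eq) repeat))))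
  distinct : Injective _≡_ _≡_ (γ ∘ cell)
  distinct {inj₁ c} {inj₁ c'} eq = cong inj₁ (sym (inColumn eq))
  distinct {inj₂ t} {inj₂ t'} eq = cong inj₂ (punchIn-injective r₀ t t' (sym (inRow eq)))
  distinct {inj₁ c} {inj₂ t} eq = contradiction eq (columnNotRow c t)
  distinct {inj₂ t} {inj₁ c} eq = contradiction (sym eq) (columnNotRow c t)

step-keepsRowRepeatsButOne : ∀ {n} {γ δ : Coloring (B (suc n))} → Step (B (suc n)) γ δ →
                             (∀ r → RowRepeats γ r) → ∃ λ r₀ → ∀ r → r ≢ r₀ → RowRepeats δ r
step-keepsRowRepeatsButOne {γ = γ} {δ} (inj₁ same) repeats =
  fzero , λ r _ → rowRepeats-unchanged {γ = γ} {δ} (λ j → same (r , j)) (repeats r)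
step-keepsRowRepeatsButOne {γ = γ} {δ} (inj₂ ((r₀ , _) , _ , same)) repeats =
  r₀ , λ r r≢r₀ →
    rowRepeats-unchanged {γ = γ} {δ} (λ j → same (r , j) (r≢r₀ ∘ cong proj₁)) (repeats r)

crossing : ∀ {p} {P : ℕ → Set p} → Decidable P → ∀ m → ¬ P 0 → P m →
           ∃ λ i → i < m × ¬ P i × P (suc i)
crossing P? zero ¬P₀ Pₘ = contradiction Pₘ ¬P₀
crossing P? (suc m) ¬P₀ Pₘ₊₁ with P? m
... | no ¬Pₘ = m , ≤-refl , ¬Pₘ , Pₘ₊₁
... | yes Pₘ with crossing P? m ¬P₀ Pₘ
...   | i , i<m , ¬Pᵢ , Pᵢ₊₁ = i , m≤n⇒m≤1+n i<m , ¬Pᵢ , Pᵢ₊₁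

manyColorsOccur : ∀ n {K m} {seq : ℕ → Coloring (B (suc n))} →
                  IsRecoloringSeq (B (suc n)) K (αB (suc n)) (βB (suc n)) m seq →
                  ∃ λ i → i ≤ m × suc n + n ≤ numColorsB (suc n) (seq i)
manyColorsOccur zero {seq = seq} _ =
  0 , z≤n , injective⇒≤numColorsB (seq 0) (λ _ → fzero , fzero) λ { {fzero} {fzero} _ → refl }
manyColorsOccur (suc n) {m = m} {seq} (start , end , colorings , steps) =
  fromCrossing (crossing (λ t → all? (columnRepeats? (seq t))) m αRainbowColumns βRepeatingColumns)
  where
  AllColumnsRepeat : ℕ → Set
  AllColumnsRepeat t = ∀ c → ColumnRepeats (seq t) c
  proper : ∀ {t} → t ≤ m → Proper _ (seq t)
  proper t≤m = proj₁ (colorings _ t≤m)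
  αRainbowColumns : ¬ AllColumnsRepeat 0
  αRainbowColumns repeats with repeats fzero
  ... | i , i' , i≢i' , repeat =
    i≢i' (toℕ-injective (trans (sym (start (i , fzero))) (trans repeat (start (i' , fzero)))))
  βRepeatingColumns : AllColumnsRepeat m
  βRepeatingColumns c = fzero , fsuc fzero , (λ ()) , trans (end _) (sym (end _))
  fromCrossing : (∃ λ i → i < m × ¬ AllColumnsRepeat i × AllColumnsRepeat (suc i)) →
                 ∃ λ i → i ≤ m × suc (suc n) + suc n ≤ numColorsB _ (seq i)
  fromCrossing (i , i<m , ¬allColumnsRepeat , allColumnsRepeat) with all? (rowRepeats? (seq i))
  ... | no ¬allRowsRepeat =
    let r , rainbowRow = ¬∀⟶∃¬ _ _ (rowRepeats? (seq i)) ¬allRowsRepeat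
        c , rainbowColumn = ¬∀⟶∃¬ _ _ (columnRepeats? (seq i)) ¬allColumnsRepeat
    in i , <⇒≤ i<m ,
       rainbowRowAndColumn⇒≤numColorsB (proper (<⇒≤ i<m)) r c rainbowRow rainbowColumn
  ... | yes allRowsRepeat =
    let r₀ , othersRepeat = step-keepsRowRepeatsButOne (steps i i<m) allRowsRepeat
    in suc i , i<m , repeatsAlmostEverywhere⇒≤numColorsB (proper i<m) r₀ othersRepeat allColumnsRepeat

changesOnlyAt⇒Step : ∀ {G} {γ δ : Coloring G} v → (∀ w → γ w ≢ δ w → w ≡ v) → Step G γ δ
changesOnlyAt⇒Step {γ = γ} {δ} v onlyAtV with γ v ≟ δ v
... | yes unchanged = inj₁ λ w → decidable-stable (γ w ≟ δ w) λ changed →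
  changed (subst (λ u → γ u ≡ δ u) (sym (onlyAtV w changed)) unchanged)
... | no changed = inj₂ (v , changed , λ w w≢v → decidable-stable (γ w ≟ δ w) (w≢v ∘ onlyAtV w))

atMostOneChange⇒Step : ∀ {k} {γ δ : Coloring (B k)} →
                       (∀ v w → γ v ≢ δ v → γ w ≢ δ w → v ≡ w) → Step (B k) γ δ
atMostOneChange⇒Step {γ = γ} {δ} unique
  with any? (λ i → any? λ j → ¬? (γ (i , j) ≟ δ (i , j)))
... | yes (i , j , changed) =
  changesOnlyAt⇒Step {B _} (i , j) λ w changedW → unique w (i , j) changedW changed
... | no noChange = inj₁ λ (i , j) → decidable-stable (γ (i , j) ≟ δ (i , j)) λ changed →
  noChange (i , j , changed)

<ᵇ-suc : ∀ a t → a ≢ t → (a <ᵇ t) ≡ (a <ᵇ suc t)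
<ᵇ-suc zero    zero    0≢0 = contradiction refl 0≢0
<ᵇ-suc zero    (suc t) _   = refl
<ᵇ-suc (suc a) zero    _   = refl
<ᵇ-suc (suc a) (suc t) a≢t = <ᵇ-suc a t (a≢t ∘ cong suc)

2*[1+n]∸1≡1+n+n : ∀ n → 2 * suc n ∸ 1 ≡ suc n + n
2*[1+n]∸1≡1+n+n n = trans (cong (n +_) (+-identityʳ (suc n))) (+-suc n n)

-- First every row i but the last moves, cell by cell, to the fresh color k + i, while the last
-- row keeps its color n; then the cells take their column color in column-major order. The only
-- clash this could create is between the last row's color n and the finished cells of the last
-- column, which are recolored last.
module RecoloringSchedule (n : ℕ) where

  private
    k K² : ℕ
    k = suc n
    K² = k * k

  Cell : Set
  Cell = Fin k × Fin k

  intermediateColor : Fin k → ℕ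
  intermediateColor i with toℕ i <? n
  ... | yes _ = k + toℕ i
  ... | no _  = toℕ i

  k+a≢toℕ : ∀ a (i : Fin k) → k + a ≢ toℕ i
  k+a≢toℕ a i eq = m+n≮m k a (subst (_< k) (sym eq) (toℕ<n i))

  intermediateColor≡toℕ⇒last : ∀ i j → intermediateColor i ≡ toℕ j → toℕ i ≡ n × toℕ j ≡ n
  intermediateColor≡toℕ⇒last i j eq with toℕ i <? n
  ... | yes _  = contradiction eq (k+a≢toℕ _ j)
  ... | no i≮n = i≡n , trans (sym eq) i≡n
    where
    i≡n : toℕ i ≡ n
    i≡n = ≤-antisym (toℕ≤pred[n] i) (≮⇒≥ i≮n)

  intermediateColor-injective : ∀ i i' → intermediateColor i ≡ intermediateColor i' → i ≡ i'
  intermediateColor-injective i i' eq with toℕ i <? n | toℕ i' <? n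
  ... | yes _ | yes _ = toℕ-injective (+-cancelˡ-≡ k _ _ eq)
  ... | yes _ | no _  = contradiction eq (k+a≢toℕ _ i')
  ... | no _  | yes _ = contradiction (sym eq) (k+a≢toℕ _ i)
  ... | no _  | no _  = toℕ-injective eq

  intermediateColor< : ∀ i → intermediateColor i < k + n
  intermediateColor< i with toℕ i <? n
  ... | yes i<n = +-monoʳ-< k i<n
  ... | no _    = <-≤-trans (toℕ<n i) (m≤m+n k n)

  rowMajor columnMajor : Cell → ℕ
  rowMajor (i , j) = toℕ (combine i j)
  columnMajor (i , j) = toℕ (combine j i)

  data Phase : Set where
    initial intermediate final : Phase

  colorIn : Phase → Cell → ℕ
  colorIn initial      (i , j) = toℕ i
  colorIn intermediate (i , j) = intermediateColor i
  colorIn final        (i , j) = toℕ j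

  phaseOf : (finished started : Bool) → Phase
  phaseOf true  _     = final
  phaseOf false true  = intermediate
  phaseOf false false = initial

  phase : ℕ → Cell → Phase
  phase t v = phaseOf (K² + columnMajor v <ᵇ t) (rowMajor v <ᵇ t)

  recoloring : ℕ → Coloring (B k)
  recoloring t v = colorIn (phase t v) v

  data PhaseAt (t : ℕ) (v : Cell) : Phase → Set where
    isFinal        : K² + columnMajor v < t → PhaseAt t v final
    isIntermediate : t ≤ K² + columnMajor v → rowMajor v < t → PhaseAt t v intermediate
    isInitial      : t ≤ K² + columnMajor v → t ≤ rowMajor v → PhaseAt t v initial

  phaseAt : ∀ t v → PhaseAt t v (phase t v)
  phaseAt t v with K² + columnMajor v <ᵇ t | <ᵇ-reflects-< (K² + columnMajor v) t
                 | rowMajor v <ᵇ t | <ᵇ-reflects-< (rowMajor v) t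
  ... | true  | ofʸ finished  | _     | _            = isFinal finished
  ... | false | ofⁿ ¬finished | true  | ofʸ started  = isIntermediate (≮⇒≥ ¬finished) started
  ... | false | ofⁿ ¬finished | false | ofⁿ ¬started = isInitial (≮⇒≥ ¬finished) (≮⇒≥ ¬started)

  rowMajor< : ∀ v → rowMajor v < K²
  rowMajor< (i , j) = toℕ<n (combine i j)

  columnMajor< : ∀ v → columnMajor v < K²
  columnMajor< (i , j) = toℕ<n (combine j i)

  rowMajor-injective : ∀ {v w} → rowMajor v ≡ rowMajor w → v ≡ w
  rowMajor-injective {i , j} {i' , j'} eq with combine-injective i j i' j' (toℕ-injective eq)
  ... | i≡i' , j≡j' = cong₂ _,_ i≡i' j≡j'

  columnMajor-injective : ∀ {v w} → columnMajor v ≡ columnMajor w → v ≡ w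
  columnMajor-injective {i , j} {i' , j'} eq with combine-injective j i j' i' (toℕ-injective eq)
  ... | j≡j' , i≡i' = cong₂ _,_ i≡i' j≡j'

  columnMajor<lastColumn : ∀ {i j i' j'} → toℕ j ≡ n → j' ≢ j →
                               columnMajor (i' , j') < columnMajor (i , j)
  columnMajor<lastColumn {i} {j} {i'} {j'} j≡n j'≢j =
    combine-monoˡ-< i' i (≤∧≢⇒< j'≤j (j'≢j ∘ toℕ-injective))
    where
    j'≤j : toℕ j' ≤ toℕ j
    j'≤j = subst (toℕ j' ≤_) (sym j≡n) (toℕ≤pred[n] j')

  noClash : ∀ {t v w p q} → PhaseAt t v p → PhaseAt t w q → Adj (B k) v w →
            colorIn p v ≢ colorIn q w
  noClash {v = i , j} {i' , j'} (isFinal _) (isFinal _) (_ , j≢j') eq = j≢j' (toℕ-injective eq)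
  noClash {v = i , j} {i' , j'} (isFinal vDone) (isIntermediate wPending _) (_ , j≢j') eq =
    <-asym (+-cancelˡ-< K² _ _ (<-≤-trans vDone wPending))
           (columnMajor<lastColumn (proj₂ (intermediateColor≡toℕ⇒last i' j (sym eq))) (≢-sym j≢j'))
  noClash {v = v} {w} (isFinal vDone) (isInitial _ wWaiting) _ _ =
    <⇒≱ (<-≤-trans (rowMajor< w) (m≤m+n K² (columnMajor v))) (<⇒≤ (<-≤-trans vDone wWaiting))
  noClash {v = i , j} {i' , j'} (isIntermediate _ _) (isIntermediate _ _) (i≢i' , _) eq =
    i≢i' (intermediateColor-injective i i' eq)
  noClash {v = i , j} {i' , j'} (isIntermediate _ _) (isInitial _ _) (i≢i' , _) eq =
    let i≡n , i'≡n = intermediateColor≡toℕ⇒last i i' eq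
    in i≢i' (toℕ-injective (trans i≡n (sym i'≡n)))
  noClash {v = i , j} {i' , j'} (isInitial _ _) (isInitial _ _) (i≢i' , _) eq = i≢i' (toℕ-injective eq)
  noClash atV@(isIntermediate _ _) atW@(isFinal _)          (i≢i' , j≢j') eq =
    noClash atW atV (≢-sym i≢i' , ≢-sym j≢j') (sym eq)
  noClash atV@(isInitial _ _)      atW@(isFinal _)          (i≢i' , j≢j') eq =
    noClash atW atV (≢-sym i≢i' , ≢-sym j≢j') (sym eq)
  noClash atV@(isInitial _ _)      atW@(isIntermediate _ _) (i≢i' , j≢j') eq =
    noClash atW atV (≢-sym i≢i' , ≢-sym j≢j') (sym eq)

  recoloring-proper : ∀ t → Proper (B k) (recoloring t)
  recoloring-proper t v w = noClash (phaseAt t v) (phaseAt t w)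

  recoloring< : ∀ t v → recoloring t v < k + n
  recoloring< t (i , j) with phase t (i , j)
  ... | initial      = <-≤-trans (toℕ<n i) (m≤m+n k n)
  ... | intermediate = intermediateColor< i
  ... | final        = <-≤-trans (toℕ<n j) (m≤m+n k n)

  recoloring-start : ∀ v → recoloring 0 v ≡ αB k v
  recoloring-start v = refl

  finishedBeforeEnd : ∀ v → K² + columnMajor v < 2 * K²
  finishedBeforeEnd v =
    subst (K² + columnMajor v <_) (cong (K² +_) (sym (+-identityʳ K²))) (+-monoʳ-< K² (columnMajor< v))

  recoloring-end : ∀ v → recoloring (2 * K²) v ≡ βB k v
  recoloring-end v with phase (2 * K²) v | phaseAt (2 * K²) v
  ... | final        | isFinal _               = refl
  ... | intermediate | isIntermediate pending _ = contradiction pending (<⇒≱ (finishedBeforeEnd v))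
  ... | initial      | isInitial pending _      = contradiction pending (<⇒≱ (finishedBeforeEnd v))

  SwitchesAt : ℕ → Cell → Set
  SwitchesAt t v = rowMajor v ≡ t ⊎ K² + columnMajor v ≡ t

  switchesAt-unique : ∀ {t v w} → SwitchesAt t v → SwitchesAt t w → v ≡ w
  switchesAt-unique (inj₁ v₁) (inj₁ w₁) = rowMajor-injective (trans v₁ (sym w₁))
  switchesAt-unique (inj₂ v₂) (inj₂ w₂) =
    columnMajor-injective (+-cancelˡ-≡ K² _ _ (trans v₂ (sym w₂)))
  switchesAt-unique {v = v} {w} (inj₁ v₁) (inj₂ w₂) =
    contradiction (trans v₁ (sym w₂)) (<⇒≢ (<-≤-trans (rowMajor< v) (m≤m+n K² (columnMajor w))))
  switchesAt-unique {v = v} {w} (inj₂ v₂) (inj₁ w₁) =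
    contradiction (trans w₁ (sym v₂)) (<⇒≢ (<-≤-trans (rowMajor< w) (m≤m+n K² (columnMajor v))))

  changed⇒switchesAt : ∀ t v → recoloring t v ≢ recoloring (suc t) v → SwitchesAt t v
  changed⇒switchesAt t v changed with rowMajor v ≟ t | K² + columnMajor v ≟ t
  ... | yes first | _          = inj₁ first
  ... | no _      | yes second = inj₂ second
  ... | no ¬first | no ¬second = contradiction (cong (λ p → colorIn p v) samePhase) changed
    where
    samePhase : phase t v ≡ phase (suc t) v
    samePhase = cong₂ phaseOf (<ᵇ-suc _ t ¬second) (<ᵇ-suc _ t ¬first)

  recoloring-step : ∀ t → Step (B k) (recoloring t) (recoloring (suc t))
  recoloring-step t = atMostOneChange⇒Step λ v w vChanged wChanged →
    switchesAt-unique (changed⇒switchesAt t v vChanged) (changed⇒switchesAt t w wChanged)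

  recoloring-isRecoloringSeq : IsRecoloringSeq (B k) (k + n) (αB k) (βB k) (2 * K²) recoloring
  recoloring-isRecoloringSeq =
    recoloring-start , recoloring-end ,
    (λ t _ → recoloring-proper t , recoloring< t) ,
    (λ t _ → recoloring-step t)

mainTheorem4 : (k : ℕ) → 1 ≤ k →
    ((K m : ℕ) (seq : ℕ → Coloring (B k)) →
        IsRecoloringSeq (B k) K (αB k) (βB k) m seq →
        Σ ℕ λ i → (i ≤ m) × (2 * k ∸ 1 ≤ numColorsB k (seq i)))
    × (Σ ℕ λ m → (m ≤ 2 * (k * k)) × Σ (ℕ → Coloring (B k)) λ seq →
        IsRecoloringSeq (B k) (2 * k ∸ 1) (αB k) (βB k) m seq)
mainTheorem4 (suc n) _ rewrite 2*[1+n]∸1≡1+n+n n =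
  (λ K m seq → manyColorsOccur n) ,
  (2 * (suc n * suc n) , ≤-refl , recoloring , recoloring-isRecoloringSeq)
  where open RecoloringSchedule n
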